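{- Let $k$ be a positive integer and let $Q_1,\dots,Q_k$ be point sets. Then there is a point set $P$ such that $P\xrightarrow{x}(Q_1,\dots,Q_k)^1$, i.e., for every coloring $c\colon P\to[k]$ there is $i\in[k]$ and a subset $Q_i'\subseteq P$ that has the same signature as $Q_i$ and all of whose points have color $i$.
   Context: All point sets are finite planar sets in general position with pairwise distinct $x$-coordinates. Two point sets $P,Q$ have the same signature if there is a bijection $f\colon P\to Q$ preserving the orientation (clockwise/counterclockwise) of every ordered triple and the order of $x$-coordinates.
   Formalization: All points have rational coordinates, both in the given point sets $Q_1,\dots,Q_k$ and in the point set $P$ whose existence is asserted. -}

module Defs where

open import Data.Nat using (ℕ)
open import Data.Fin using (Fin)
open import Data.Rational using (ℚ; _<_; _*_; _-_; 0ℚ)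
open import Data.Product using (_×_; _,_; proj₁; proj₂; Σ; ∃-syntax)
open import Relation.Binary.PropositionalEquality using (_≡_; _≢_)
open import Function using (_∘_)
open import Function.Bundles using (_↔_; _⇔_; Inverse)
open import Function.Definitions using (Injective)

Point : Set
Point = ℚ × ℚ

xc : Point → ℚ
xc = proj₁

yc : Point → ℚ
yc = proj₂

det : Point → Point → Point → ℚ
det p q r = ((xc q - xc p) * (yc r - yc p)) - ((yc q - yc p) * (xc r - xc p))

record PointSet : Set where
  field
    size      : ℕ
    pt        : Fin size → Point
    distinctX : ∀ i j → i ≢ j → xc (pt i) ≢ xc (pt j)
    genPos    : ∀ i j k → i ≢ j → j ≢ k → i ≢ k → det (pt i) (pt j) (pt k) ≢ 0ℚ
open PointSet public

SameSignature : ∀ {n m} → (Fin n → Point) → (Fin m → Point) → Set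
SameSignature {n} {m} p q =
  Σ (Fin n ↔ Fin m) λ f →
    let g = Inverse.to f in
      (∀ a b → (xc (p a) < xc (p b)) ⇔ (xc (q (g a)) < xc (q (g b))))
    × (∀ a b c → (0ℚ < det (p a) (p b) (p c)) ⇔ (0ℚ < det (q (g a)) (q (g b)) (q (g c))))

HasColouredCopy : ∀ {k} (P : PointSet) → (Fin (size P) → Fin k) → Fin k → PointSet → Set
HasColouredCopy P col i Q =
  Σ ℕ λ m → Σ (Fin m → Fin (size P)) λ g →
    Injective _≡_ _≡_ g × (∀ a → col (g a) ≡ i) × SameSignature (pt P ∘ g) (pt Q)

Arrows : ∀ {k} → PointSet → (Fin k → PointSet) → Set
Arrows {k} P Q = ∀ (col : Fin (size P) → Fin k) → ∃[ i ] HasColouredCopy P col i (Q i)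

-- Induction on k.  Given A with A →ˣ (Q₂,…,Q_k), put a translate of Q₁ at every
-- point of a huge sheared copy of A.  For a large scale r the x-differences and
-- orientation determinants of the resulting set are polynomials in r whose
-- leading coefficients are the corresponding quantities of A (for points in
-- different copies) or of Q₁ (within one copy, where they are even constant).
-- So every copy is similar to Q₁ and every transversal of the copies is
-- similar to A.  A colouring now either makes some copy entirely of colour 1,
-- or chooses a point of another colour in every copy; the latter induces a
-- (k−1)-colouring of A, and a monochromatic copy of some Q_i found in A lifts
-- along that transversal.
module Submission where

open import Defs
open import Data.Nat using (ℕ; zero; suc)
import Data.Nat as ℕ
open import Data.Fin using (Fin; zero; suc; combine; remQuot; punchOut)
open import Data.Fin.Properties
  using (_≟_; any?; all?; ¬∀⟶∃¬; combine-injective;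
         remQuot-combine; combine-remQuot; punchIn-punchOut)
open import Data.Product using (∃-syntax; _×_; _,_; proj₁; proj₂; uncurry)
open import Data.List using (List; []; _∷_; map)
open import Data.Rational
  using (ℚ; _+_; _*_; _-_; -_; 0ℚ; 1ℚ; _<_; _≤_; _⊔_; 1/_; NonZero; ≢-nonZero; nonNegative)
open import Data.Rational.Properties
  using (≤-refl; <⇒≤; <-≤-trans; ≤-<-trans; <-cmp; <-asym; <-irrefl; p⊔q≤r⇒p≤r; p⊔q≤r⇒q≤r;
         neg-antimono-<; neg-antimono-≤; +-monoˡ-<; +-monoʳ-≤; +-inverseʳ;
         *-monoʳ-≤-nonNeg; *-monoˡ-≤-nonNeg; *-inverseˡ; *-assoc; *-identityˡ; *-zeroʳ;
         +-identityˡ; +-0-group)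
open import Algebra.Properties.Group +-0-group using (x∙y⁻¹≈ε⇒x≈y; x≈y⇒x∙y⁻¹≈ε; ⁻¹-involutive)
open import Data.Rational.Solver using (module +-*-Solver)
open +-*-Solver
open import Data.Empty using (⊥-elim)
open import Function using (_∘_; id)
open import Function.Bundles using (_⇔_; mk⇔)
import Function.Properties.Equivalence as ⇔
open import Function.Construct.Identity using (↔-id)
open import Relation.Binary.Definitions using (tri<; tri≈; tri>)
open import Relation.Binary.PropositionalEquality
open import Relation.Nullary using (Dec; yes; no)
open import Relation.Nullary.Decidable using (¬?)

p<q⇔0<q-p : ∀ {p q} → (p < q) ⇔ (0ℚ < q - p)
p<q⇔0<q-p {p} {q} = mk⇔
  (λ p<q → subst (_< q - p) (+-inverseʳ p) (+-monoˡ-< (- p) p<q))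
  (λ 0<q-p → subst₂ _<_ (+-identityˡ p)
                        (solve 2 (λ p q → (q :- p) :+ p := q) refl p q)
                        (+-monoˡ-< p 0<q-p))

q≢p⇒q-p≢0 : ∀ {p q} → q ≢ p → q - p ≢ 0ℚ
q≢p⇒q-p≢0 q≢p = q≢p ∘ x∙y⁻¹≈ε⇒x≈y _ _

q-p≢0⇒p≢q : ∀ {p q} → q - p ≢ 0ℚ → p ≢ q
q-p≢0⇒p≢q q-p≢0 = q-p≢0 ∘ x≈y⇒x∙y⁻¹≈ε ∘ sym

p*q≢0 : ∀ {p q} → p ≢ 0ℚ → q ≢ 0ℚ → p * q ≢ 0ℚ
p*q≢0 {p} {q} p≢0 q≢0 pq≡0 = q≢0 (begin
  q                 ≡⟨ sym (*-identityˡ q) ⟩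
  1ℚ * q            ≡⟨ cong (_* q) (sym (*-inverseˡ p)) ⟩
  (1/ p * p) * q    ≡⟨ *-assoc (1/ p) p q ⟩
  1/ p * (p * q)    ≡⟨ cong (1/ p *_) pq≡0 ⟩
  1/ p * 0ℚ         ≡⟨ *-zeroʳ (1/ p) ⟩
  0ℚ                ∎)
  where
    open ≡-Reasoning
    instance
      p-nonZero : NonZero p
      p-nonZero = ≢-nonZero p≢0

HasSignOf : ℚ → ℚ → Set
HasSignOf x c = ((0ℚ < x) ⇔ (0ℚ < c)) × x ≢ 0ℚ

pos⇒HasSignOf : ∀ {x c} → 0ℚ < x → 0ℚ < c → HasSignOf x c
pos⇒HasSignOf 0<x 0<c = mk⇔ (λ _ → 0<c) (λ _ → 0<x) , λ x≡0 → <-irrefl (sym x≡0) 0<x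

neg⇒HasSignOf : ∀ {x c} → x < 0ℚ → c < 0ℚ → HasSignOf x c
neg⇒HasSignOf x<0 c<0 =
  mk⇔ (λ 0<x → ⊥-elim (<-asym 0<x x<0)) (λ 0<c → ⊥-elim (<-asym 0<c c<0)) , λ x≡0 → <-irrefl x≡0 x<0

diff≡⇒<⇔< : ∀ {p q p′ q′} → q - p ≡ q′ - p′ → (p < q) ⇔ (p′ < q′)
diff≡⇒<⇔< diff≡ = ⇔.trans p<q⇔0<q-p (subst (λ d → (0ℚ < d) ⇔ _) (sym diff≡) (⇔.sym p<q⇔0<q-p))

diffSign⇒<⇔< : ∀ {p q p′ q′} → HasSignOf (q - p) (q′ - p′) → (p < q) ⇔ (p′ < q′)
diffSign⇒<⇔< (same-sign , _) = ⇔.trans p<q⇔0<q-p (⇔.trans same-sign (⇔.sym p<q⇔0<q-p))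

Eventually : (ℚ → Set) → Set
Eventually P = ∃[ r₀ ] ∀ r → r₀ ≤ r → P r

eventually-≥ : ∀ r₀ → Eventually (r₀ ≤_)
eventually-≥ r₀ = r₀ , λ _ r₀≤r → r₀≤r

eventually-map : ∀ {P Q : ℚ → Set} → (∀ r → P r → Q r) → Eventually P → Eventually Q
eventually-map f (r₀ , P-from-r₀) = r₀ , λ r r₀≤r → f r (P-from-r₀ r r₀≤r)

eventually-× : ∀ {P Q : ℚ → Set} → Eventually P → Eventually Q → Eventually (λ r → P r × Q r)
eventually-× (r₀ , P-from-r₀) (r₁ , Q-from-r₁) =
  r₀ ⊔ r₁ , λ r r₀⊔r₁≤r → P-from-r₀ r (p⊔q≤r⇒p≤r r₀ r₁ r₀⊔r₁≤r) , Q-from-r₁ r (p⊔q≤r⇒q≤r r₀ r₁ r₀⊔r₁≤r)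

eventually-∀ : ∀ {n} {P : Fin n → ℚ → Set} → (∀ i → Eventually (P i)) → Eventually (λ r → ∀ i → P i r)
eventually-∀ {zero}  _    = 0ℚ , λ _ _ ()
eventually-∀ {suc n} {P} ev-P = eventually-map cons (eventually-× (ev-P zero) (eventually-∀ (ev-P ∘ suc)))
  where
    cons : ∀ r → P zero r × (∀ i → P (suc i) r) → ∀ i → P i r
    cons r (P₀ , _)     zero    = P₀
    cons r (_  , P-suc) (suc i) = P-suc i

eventually-→ : ∀ {A : Set} {P : ℚ → Set} → Dec A → (A → Eventually P) → Eventually (λ r → A → P r)
eventually-→ (yes a) ev-P = eventually-map (λ _ Pr _ → Pr) (ev-P a)
eventually-→ (no ¬a) _    = 0ℚ , λ _ _ a → ⊥-elim (¬a a)

eventually⇒∃ : ∀ {P : ℚ → Set} → Eventually P → ∃[ r ] P r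
eventually⇒∃ (r₀ , P-from-r₀) = r₀ , P-from-r₀ r₀ ≤-refl

-- horner (d₀ ∷ ⋯ ∷ dₙ₋₁ ∷ []) c r = d₀ + d₁ r + ⋯ + dₙ₋₁ rⁿ⁻¹ + c rⁿ
horner : List ℚ → ℚ → ℚ → ℚ
horner []       c r = c
horner (d ∷ ds) c r = d + r * horner ds c r

horner-neg : ∀ ds c r → horner (map -_ ds) (- c) r ≡ - horner ds c r
horner-neg []       c r = refl
horner-neg (d ∷ ds) c r = begin
  - d + r * horner (map -_ ds) (- c) r ≡⟨ cong (λ h → - d + r * h) (horner-neg ds c r) ⟩
  - d + r * - horner ds c r            ≡⟨ solve 3 (λ d r h → :- d :+ r :* (:- h) := :- (d :+ r :* h)) refl d r _ ⟩
  - (d + r * horner ds c r)            ∎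
  where open ≡-Reasoning

horner-eventually-≥ : ∀ ds {c} → 0ℚ < c → Eventually (λ r → c ≤ horner ds c r)
horner-eventually-≥ []           _   = 0ℚ , λ _ _ → ≤-refl
horner-eventually-≥ (d ∷ ds) {c} 0<c =
  eventually-map step (eventually-× (eventually-≥ 0ℚ) (eventually-× (eventually-≥ K) (horner-eventually-≥ ds 0<c)))
  where
    instance
      c-nonZero : NonZero c
      c-nonZero = ≢-nonZero λ c≡0 → <-irrefl (sym c≡0) 0<c
    K : ℚ
    K = (c - d) * 1/ c
    c≡d+K*c : c ≡ d + K * c
    c≡d+K*c = begin
      c                       ≡⟨ solve 2 (λ c d → c := d :+ (c :- d) :* con 1ℚ) refl c d ⟩
      d + (c - d) * 1ℚ        ≡⟨ cong (λ x → d + (c - d) * x) (sym (*-inverseˡ c)) ⟩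
      d + (c - d) * (1/ c * c) ≡⟨ cong (d +_) (sym (*-assoc (c - d) (1/ c) c)) ⟩
      d + K * c               ∎
      where open ≡-Reasoning
    step : ∀ r → 0ℚ ≤ r × K ≤ r × c ≤ horner ds c r → c ≤ d + r * horner ds c r
    step r (0≤r , K≤r , c≤h) = begin
      c                      ≡⟨ c≡d+K*c ⟩
      d + K * c              ≤⟨ +-monoʳ-≤ d (*-monoʳ-≤-nonNeg c {{nonNegative (<⇒≤ 0<c)}} K≤r) ⟩
      d + r * c              ≤⟨ +-monoʳ-≤ d (*-monoˡ-≤-nonNeg r {{nonNegative 0≤r}} c≤h) ⟩
      d + r * horner ds c r  ∎
      where open Data.Rational.Properties.≤-Reasoning

horner-eventually-signOf : ∀ ds {c} → c ≢ 0ℚ → Eventually (λ r → HasSignOf (horner ds c r) c)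
horner-eventually-signOf ds {c} c≢0 with <-cmp 0ℚ c
... | tri< 0<c _ _ =
  eventually-map (λ r c≤h → pos⇒HasSignOf (<-≤-trans 0<c c≤h) 0<c) (horner-eventually-≥ ds 0<c)
... | tri≈ _ 0≡c _ = ⊥-elim (c≢0 (sym 0≡c))
... | tri> _ _ c<0 =
  eventually-map (λ r -c≤-h → neg⇒HasSignOf (≤-<-trans (h≤c r -c≤-h) c<0) c<0)
                 (horner-eventually-≥ (map -_ ds) (neg-antimono-< c<0))
  where
    h≤c : ∀ r → - c ≤ horner (map -_ ds) (- c) r → horner ds c r ≤ c
    h≤c r -c≤-h = subst₂ _≤_ (⁻¹-involutive _) (⁻¹-involutive c)
                         (neg-antimono-≤ (subst (- c ≤_) (horner-neg ds c r) -c≤-h))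

record HasLeadingCoefficient (f : ℚ → ℚ) (c : ℚ) : Set where
  field
    lowerCoefficients : List ℚ
    ≗horner           : f ≗ horner lowerCoefficients c

eventually-signOf : ∀ {f c} → HasLeadingCoefficient f c → c ≢ 0ℚ → Eventually (λ r → HasSignOf (f r) c)
eventually-signOf record { lowerCoefficients = ds ; ≗horner = f≗h } c≢0 =
  eventually-map (λ r → subst (λ x → HasSignOf x _) (sym (f≗h r))) (horner-eventually-signOf ds c≢0)

infix 4 _≋_

record _≋_ {n} (p q : Fin n → Point) : Set where
  field
    x-order     : ∀ a b → (xc (p a) < xc (p b)) ⇔ (xc (q a) < xc (q b))
    orientation : ∀ a b c → (0ℚ < det (p a) (p b) (p c)) ⇔ (0ℚ < det (q a) (q b) (q c))
open _≋_

≋-trans : ∀ {n} {p q s : Fin n → Point} → p ≋ q → q ≋ s → p ≋ s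
≋-trans p≋q q≋s = record
  { x-order     = λ a b → ⇔.trans (x-order p≋q a b) (x-order q≋s a b)
  ; orientation = λ a b c → ⇔.trans (orientation p≋q a b c) (orientation q≋s a b c)
  }

≋-∘ : ∀ {n m} {p q : Fin n → Point} → p ≋ q → (h : Fin m → Fin n) → p ∘ h ≋ q ∘ h
≋-∘ p≋q h = record
  { x-order     = λ a b → x-order p≋q (h a) (h b)
  ; orientation = λ a b c → orientation p≋q (h a) (h b) (h c)
  }

≗⇒≋ : ∀ {n} {p q : Fin n → Point} → p ≗ q → p ≋ q
≗⇒≋ {p = p} {q} p≗q = record { x-order = x-order′ ; orientation = orientation′ }
  where
    x-order′ : ∀ a b → (xc (p a) < xc (p b)) ⇔ (xc (q a) < xc (q b))
    x-order′ a b rewrite p≗q a | p≗q b = ⇔.refl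
    orientation′ : ∀ a b c → (0ℚ < det (p a) (p b) (p c)) ⇔ (0ℚ < det (q a) (q b) (q c))
    orientation′ a b c rewrite p≗q a | p≗q b | p≗q c = ⇔.refl

SameSignature-refl : ∀ {n} (p : Fin n → Point) → SameSignature p p
SameSignature-refl _ = ↔-id _ , (λ _ _ → ⇔.refl) , (λ _ _ _ → ⇔.refl)

≋-SameSignature : ∀ {n m} {p q : Fin n → Point} (s : Fin m → Point) → p ≋ q → SameSignature q s → SameSignature p s
≋-SameSignature _ p≋q (f , x-order-q , orientation-q) =
  f , (λ a b → ⇔.trans (x-order p≋q a b) (x-order-q a b))
    , (λ a b c → ⇔.trans (orientation p≋q a b c) (orientation-q a b c))

det-cycle : ∀ p q s → det p q s ≡ det q s p
det-cycle p q s = solve 6 (λ px py qx qy sx sy →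
  ((qx :- px) :* (sy :- py)) :- ((qy :- py) :* (sx :- px)) :=
  ((sx :- qx) :* (py :- qy)) :- ((sy :- qy) :* (px :- qx)))
  refl (xc p) (yc p) (xc q) (yc q) (xc s) (yc s)

det-repeat : ∀ p q → det p p q ≡ 0ℚ
det-repeat p q = solve 4 (λ px py qx qy → ((px :- px) :* (qy :- py)) :- ((py :- py) :* (qx :- px)) := con 0ℚ)
  refl (xc p) (yc p) (xc q) (yc q)

≋-fromDistinct : ∀ {n} {p q : Fin n → Point} →
  (∀ a b → a ≢ b → (xc (p a) < xc (p b)) ⇔ (xc (q a) < xc (q b))) →
  (∀ a b c → a ≢ b → b ≢ c → a ≢ c → (0ℚ < det (p a) (p b) (p c)) ⇔ (0ℚ < det (q a) (q b) (q c))) →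
  p ≋ q
≋-fromDistinct {p = p} {q} x-order-distinct orientation-distinct =
  record { x-order = x-order′ ; orientation = orientation′ }
  where
    both-zero : ∀ {x y} → x ≡ 0ℚ → y ≡ 0ℚ → (0ℚ < x) ⇔ (0ℚ < y)
    both-zero x≡0 y≡0 = mk⇔ (⊥-elim ∘ <-irrefl (sym x≡0)) (⊥-elim ∘ <-irrefl (sym y≡0))
    repeat₂₃ : ∀ f a b → det (f a) (f b) (f b) ≡ 0ℚ
    repeat₂₃ f a b = trans (det-cycle (f a) (f b) (f b)) (det-repeat (f b) (f a))
    repeat₁₃ : ∀ f a b → det (f a) (f b) (f a) ≡ 0ℚ
    repeat₁₃ f a b = trans (det-cycle (f a) (f b) (f a)) (repeat₂₃ f b a)
    x-order′ : ∀ a b → (xc (p a) < xc (p b)) ⇔ (xc (q a) < xc (q b))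
    x-order′ a b with a ≟ b
    ... | yes refl = mk⇔ (⊥-elim ∘ <-irrefl refl) (⊥-elim ∘ <-irrefl refl)
    ... | no a≢b   = x-order-distinct a b a≢b
    orientation′ : ∀ a b c → (0ℚ < det (p a) (p b) (p c)) ⇔ (0ℚ < det (q a) (q b) (q c))
    orientation′ a b c with a ≟ b | b ≟ c | a ≟ c
    ... | yes refl | _        | _        = both-zero (det-repeat (p a) (p c)) (det-repeat (q a) (q c))
    ... | no _     | yes refl | _        = both-zero (repeat₂₃ p a b) (repeat₂₃ q a b)
    ... | no _     | no _     | yes refl = both-zero (repeat₁₃ p a b) (repeat₁₃ q a b)
    ... | no a≢b   | no b≢c   | no a≢c   = orientation-distinct a b c a≢b b≢c a≢c

record Inflation (A B P : PointSet) : Set where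
  field
    embed               : Fin (size A) → Fin (size B) → Fin (size P)
    embed-injective     : ∀ a u c w → embed a u ≡ embed c w → a ≡ c × u ≡ w
    block-similar       : ∀ a → pt P ∘ embed a ≋ pt B
    transversal-similar : ∀ (t : Fin (size A) → Fin (size B)) → pt P ∘ (λ a → embed a (t a)) ≋ pt A

module _ {k} {A P : PointSet} {Q : Fin (suc k) → PointSet} (inflation : Inflation A (Q zero) P) where
  open Inflation inflation

  block-copy : ∀ (col : Fin (size P) → Fin (suc k)) a → (∀ u → col (embed a u) ≡ zero) →
               HasColouredCopy P col zero (Q zero)
  block-copy col a monochromatic =
    size (Q zero) , embed a , (λ e → proj₂ (embed-injective a _ a _ e)) , monochromatic ,
    ≋-SameSignature (pt (Q zero)) (block-similar a) (SameSignature-refl (pt (Q zero)))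

  transversal-copy : ∀ (col : Fin (size P) → Fin (suc k)) (t : Fin (size A) → Fin (size (Q zero))) →
                     (∀ a → zero ≢ col (embed a (t a))) → Arrows A (Q ∘ suc) → ∃[ i ] HasColouredCopy P col i (Q i)
  transversal-copy col t avoids-zero A→Q with A→Q (λ a → punchOut (avoids-zero a))
  ... | i , m , h , h-injective , h-colour , h-similar =
    suc i , m , transversal ∘ h , (λ e → h-injective (proj₁ (embed-injective _ _ _ _ e))) , colour ,
    ≋-SameSignature (pt (Q (suc i))) (≋-∘ (transversal-similar t) h) h-similar
    where
      transversal : Fin (size A) → Fin (size P)
      transversal a = embed a (t a)
      colour : ∀ j → col (transversal (h j)) ≡ suc i
      colour j = trans (sym (punchIn-punchOut (avoids-zero (h j)))) (cong suc (h-colour j))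

  inflation-arrows : Arrows A (Q ∘ suc) → Arrows P Q
  inflation-arrows A→Q col with any? (λ a → all? (λ u → col (embed a u) ≟ zero))
  ... | yes (a , monochromatic) = zero , block-copy col a monochromatic
  ... | no no-monochromatic-block =
    transversal-copy col (λ a → proj₁ (nonzero a)) (λ a → ≢-sym (proj₂ (nonzero a))) A→Q
    where
      nonzero : ∀ a → ∃[ u ] col (embed a u) ≢ zero
      nonzero a = ¬∀⟶∃¬ _ _ (λ u → col (embed a u) ≟ zero) (no-monochromatic-block ∘ (a ,_))

-- u translated by r² S_r(a), where S_r(x , y) = (x , y + r x) is a shear.  The shear
-- preserves orientations, and its r³ term gives triples with two points in one block
-- the nonzero leading coefficient of det-blowUp-twoInBlock.
blowUp : ℚ → Point → Point → Point
blowUp r a u = (r * r * xc a + xc u , r * r * (yc a + r * xc a) + yc u)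

xc-blowUp-sameBlock : ∀ r a u w → xc (blowUp r a w) - xc (blowUp r a u) ≡ xc w - xc u
xc-blowUp-sameBlock r a u w = solve 4 (λ ax ux wx r → (r :* r :* ax :+ wx) :- (r :* r :* ax :+ ux) := wx :- ux)
  refl (xc a) (xc u) (xc w) r

det-blowUp-sameBlock : ∀ r a u v w → det (blowUp r a u) (blowUp r a v) (blowUp r a w) ≡ det u v w
det-blowUp-sameBlock r a u v w = solve 9 (λ ax ay ux uy vx vy wx wy r →
  let X t = r :* r :* ax :+ t ; Y t = r :* r :* (ay :+ r :* ax) :+ t in
  ((X vx :- X ux) :* (Y wy :- Y uy)) :- ((Y vy :- Y uy) :* (X wx :- X ux)) :=
  ((vx :- ux) :* (wy :- uy)) :- ((vy :- uy) :* (wx :- ux)))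
  refl (xc a) (yc a) (xc u) (yc u) (xc v) (yc v) (xc w) (yc w) r

xc-blowUp : ∀ a c u w → HasLeadingCoefficient (λ r → xc (blowUp r c w) - xc (blowUp r a u)) (xc c - xc a)
xc-blowUp a c u w = record
  { lowerCoefficients = xc w - xc u ∷ 0ℚ ∷ []
  ; ≗horner = solve 5 (λ ax cx ux wx r →
      (r :* r :* cx :+ wx) :- (r :* r :* ax :+ ux) := (wx :- ux) :+ r :* (con 0ℚ :+ r :* (cx :- ax)))
      refl (xc a) (xc c) (xc u) (xc w)
  }

det-blowUp-twoInBlock : ∀ a c u v w →
  HasLeadingCoefficient (λ r → det (blowUp r a u) (blowUp r a v) (blowUp r c w)) ((xc v - xc u) * (xc c - xc a))
det-blowUp-twoInBlock a c u v w = record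
  { lowerCoefficients = det u v w ∷ 0ℚ ∷ (xc v - xc u) * (yc c - yc a) - (yc v - yc u) * (xc c - xc a) ∷ []
  ; ≗horner = solve 11 (λ ax ay cx cy ux uy vx vy wx wy r →
      let X x t = r :* r :* x :+ t ; Y x y t = r :* r :* (y :+ r :* x) :+ t in
      ((X ax vx :- X ax ux) :* (Y cx cy wy :- Y ax ay uy)) :- ((Y ax ay vy :- Y ax ay uy) :* (X cx wx :- X ax ux)) :=
      ((vx :- ux) :* (wy :- uy) :- (vy :- uy) :* (wx :- ux)) :+ r :* (con 0ℚ :+ r :* (
        ((vx :- ux) :* (cy :- ay) :- (vy :- uy) :* (cx :- ax)) :+ r :* ((vx :- ux) :* (cx :- ax)))))
      refl (xc a) (yc a) (xc c) (yc c) (xc u) (yc u) (xc v) (yc v) (xc w) (yc w)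
  }

det-blowUp : ∀ a b c u v w →
  HasLeadingCoefficient (λ r → det (blowUp r a u) (blowUp r b v) (blowUp r c w)) (det a b c)
det-blowUp a b c u v w = record
  { lowerCoefficients =
      det u v w ∷ 0ℚ ∷
      (xc b - xc a) * (yc w - yc u) + (xc v - xc u) * (yc c - yc a)
        - (yc b - yc a) * (xc w - xc u) - (yc v - yc u) * (xc c - xc a) ∷
      (xc v - xc u) * (xc c - xc a) - (xc b - xc a) * (xc w - xc u) ∷ []
  ; ≗horner = solve 13 (λ ax ay bx by cx cy ux uy vx vy wx wy r →
      let X x t = r :* r :* x :+ t ; Y x y t = r :* r :* (y :+ r :* x) :+ t in
      ((X bx vx :- X ax ux) :* (Y cx cy wy :- Y ax ay uy)) :- ((Y bx by vy :- Y ax ay uy) :* (X cx wx :- X ax ux)) :=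
      ((vx :- ux) :* (wy :- uy) :- (vy :- uy) :* (wx :- ux)) :+ r :* (con 0ℚ :+ r :* (
        ((bx :- ax) :* (wy :- uy) :+ (vx :- ux) :* (cy :- ay) :- (by :- ay) :* (wx :- ux) :- (vy :- uy) :* (cx :- ax))
        :+ r :* (((vx :- ux) :* (cx :- ax) :- (bx :- ax) :* (wx :- ux))
        :+ r :* ((bx :- ax) :* (cy :- ay) :- (by :- ay) :* (cx :- ax))))))
      refl (xc a) (yc a) (xc b) (yc b) (xc c) (yc c) (xc u) (yc u) (xc v) (yc v) (xc w) (yc w)
  }

remQuot-injective : ∀ {m} n {i j : Fin (m ℕ.* n)} → remQuot {m} n i ≡ remQuot n j → i ≡ j
remQuot-injective {m} n {i} {j} e =
  trans (sym (combine-remQuot {m} n i)) (trans (cong (uncurry combine) e) (combine-remQuot {m} n j))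

module BlowUp (A B : PointSet) where

  point : ℚ → Fin (size A) × Fin (size B) → Point
  point r (a , u) = blowUp r (pt A a) (pt B u)

  CrossBlockX : ℚ → Set
  CrossBlockX r = ∀ a c u w → a ≢ c →
    HasSignOf (xc (point r (c , w)) - xc (point r (a , u))) (xc (pt A c) - xc (pt A a))

  TwoInBlockNondegenerate : ℚ → Set
  TwoInBlockNondegenerate r = ∀ a c u v w → a ≢ c → u ≢ v →
    det (point r (a , u)) (point r (a , v)) (point r (c , w)) ≢ 0ℚ

  CrossBlockOrientation : ℚ → Set
  CrossBlockOrientation r = ∀ a b c u v w → a ≢ b → b ≢ c → a ≢ c →
    HasSignOf (det (point r (a , u)) (point r (b , v)) (point r (c , w))) (det (pt A a) (pt A b) (pt A c))

  record Generic (r : ℚ) : Set where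
    constructor generic
    field
      cross-block-x              : CrossBlockX r
      two-in-block-nondegenerate : TwoInBlockNondegenerate r
      cross-block-orientation    : CrossBlockOrientation r

  A-xdiff≢0 : ∀ {a c} → a ≢ c → xc (pt A c) - xc (pt A a) ≢ 0ℚ
  A-xdiff≢0 {a} {c} a≢c = q≢p⇒q-p≢0 (distinctX A c a (≢-sym a≢c))

  B-xdiff≢0 : ∀ {u w} → u ≢ w → xc (pt B w) - xc (pt B u) ≢ 0ℚ
  B-xdiff≢0 {u} {w} u≢w = q≢p⇒q-p≢0 (distinctX B w u (≢-sym u≢w))

  eventually-generic : Eventually Generic
  eventually-generic =
    eventually-map (λ _ (x , n , o) → generic x n o)
                   (eventually-× eventually-x (eventually-× eventually-nondegenerate eventually-orientation))
    where
      eventually-x : Eventually CrossBlockX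
      eventually-x =
        eventually-∀ λ a → eventually-∀ λ c → eventually-∀ λ u → eventually-∀ λ w →
        eventually-→ (¬? (a ≟ c)) λ a≢c →
        eventually-signOf (xc-blowUp (pt A a) (pt A c) (pt B u) (pt B w)) (A-xdiff≢0 a≢c)
      eventually-nondegenerate : Eventually TwoInBlockNondegenerate
      eventually-nondegenerate =
        eventually-∀ λ a → eventually-∀ λ c → eventually-∀ λ u → eventually-∀ λ v → eventually-∀ λ w →
        eventually-→ (¬? (a ≟ c)) λ a≢c → eventually-→ (¬? (u ≟ v)) λ u≢v →
        eventually-map (λ _ → proj₂)
          (eventually-signOf (det-blowUp-twoInBlock (pt A a) (pt A c) (pt B u) (pt B v) (pt B w))
                             (p*q≢0 (B-xdiff≢0 u≢v) (A-xdiff≢0 a≢c)))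
      eventually-orientation : Eventually CrossBlockOrientation
      eventually-orientation =
        eventually-∀ λ a → eventually-∀ λ b → eventually-∀ λ c →
        eventually-∀ λ u → eventually-∀ λ v → eventually-∀ λ w →
        eventually-→ (¬? (a ≟ b)) λ a≢b → eventually-→ (¬? (b ≟ c)) λ b≢c → eventually-→ (¬? (a ≟ c)) λ a≢c →
        eventually-signOf (det-blowUp (pt A a) (pt A b) (pt A c) (pt B u) (pt B v) (pt B w))
                          (genPos A a b c a≢b b≢c a≢c)

  module _ {r} (gen : Generic r) where
    open Generic gen

    distinct-x : ∀ p q → p ≢ q → xc (point r p) ≢ xc (point r q)
    distinct-x (a , u) (c , w) p≢q with a ≟ c
    ... | yes refl = q-p≢0⇒p≢q (subst (_≢ 0ℚ) (sym (xc-blowUp-sameBlock r (pt A a) (pt B u) (pt B w)))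
                                                (B-xdiff≢0 (p≢q ∘ cong (a ,_))))
    ... | no a≢c   = q-p≢0⇒p≢q (proj₂ (cross-block-x a c u w a≢c))

    -- det is invariant under cyclic shifts, which move two points of one block to the front.
    nondegenerate : ∀ p q s → p ≢ q → q ≢ s → p ≢ s → det (point r p) (point r q) (point r s) ≢ 0ℚ
    nondegenerate (a , u) (b , v) (c , w) p≢q q≢s p≢s with a ≟ b | b ≟ c | a ≟ c
    ... | yes refl | yes refl | _ =
      subst (_≢ 0ℚ) (sym (det-blowUp-sameBlock r (pt A a) (pt B u) (pt B v) (pt B w)))
            (genPos B u v w (p≢q ∘ cong (a ,_)) (q≢s ∘ cong (a ,_)) (p≢s ∘ cong (a ,_)))
    ... | yes refl | no b≢c   | _ = two-in-block-nondegenerate a c u v w b≢c (p≢q ∘ cong (a ,_))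
    ... | no a≢b   | yes refl | _ =
      subst (_≢ 0ℚ) (sym (det-cycle P Q S)) (two-in-block-nondegenerate b a v w u (≢-sym a≢b) (q≢s ∘ cong (b ,_)))
      where P = point r (a , u) ; Q = point r (b , v) ; S = point r (b , w)
    ... | no a≢b   | no _     | yes refl =
      subst (_≢ 0ℚ) (sym (trans (det-cycle P Q S) (det-cycle Q S P)))
            (two-in-block-nondegenerate a b w u v a≢b (p≢s ∘ cong (a ,_) ∘ sym))
      where P = point r (a , u) ; Q = point r (b , v) ; S = point r (a , w)
    ... | no a≢b   | no b≢c   | no a≢c = proj₂ (cross-block-orientation a b c u v w a≢b b≢c a≢c)

    index : Fin (size A ℕ.* size B) → Fin (size A) × Fin (size B)
    index = remQuot (size B)

    index-≢ : ∀ {i j} → i ≢ j → index i ≢ index j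
    index-≢ i≢j = i≢j ∘ remQuot-injective (size B)

    blown-up : PointSet
    blown-up = record
      { size      = size A ℕ.* size B
      ; pt        = point r ∘ index
      ; distinctX = λ i j i≢j → distinct-x (index i) (index j) (index-≢ i≢j)
      ; genPos    = λ i j k i≢j j≢k i≢k →
                      nondegenerate (index i) (index j) (index k) (index-≢ i≢j) (index-≢ j≢k) (index-≢ i≢k)
      }

    block-≋ : ∀ a → point r ∘ (a ,_) ≋ pt B
    block-≋ a = record
      { x-order     = λ u w → diff≡⇒<⇔< (xc-blowUp-sameBlock r (pt A a) (pt B u) (pt B w))
      ; orientation = λ u v w →
          subst (λ d → (0ℚ < d) ⇔ _) (sym (det-blowUp-sameBlock r (pt A a) (pt B u) (pt B v) (pt B w))) ⇔.refl
      }

    transversal-≋ : ∀ (t : Fin (size A) → Fin (size B)) → point r ∘ (λ a → (a , t a)) ≋ pt A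
    transversal-≋ t = ≋-fromDistinct
      (λ a c a≢c → diffSign⇒<⇔< (cross-block-x a c (t a) (t c) a≢c))
      (λ a b c a≢b b≢c a≢c → proj₁ (cross-block-orientation a b c (t a) (t b) (t c) a≢b b≢c a≢c))

    pt-combine : ∀ a u → pt blown-up (combine a u) ≡ point r (a , u)
    pt-combine a u = cong (point r) (remQuot-combine a u)

    inflation : Inflation A B blown-up
    inflation = record
      { embed               = combine
      ; embed-injective     = combine-injective
      ; block-similar       = λ a → ≋-trans (≗⇒≋ (pt-combine a)) (block-≋ a)
      ; transversal-similar = λ t → ≋-trans (≗⇒≋ (λ a → pt-combine a (t a))) (transversal-≋ t)
      }

inflation-exists : ∀ A B → ∃[ P ] Inflation A B P
inflation-exists A B = let _ , gen = eventually⇒∃ eventually-generic in blown-up gen , inflation gen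
  where open BlowUp A B

arrows-one-colour : (Q : Fin 1 → PointSet) → Arrows (Q zero) Q
arrows-one-colour Q col =
  zero , size (Q zero) , id , id , (λ a → only-colour (col a)) , SameSignature-refl (pt (Q zero))
  where
    only-colour : (i : Fin 1) → i ≡ zero
    only-colour zero = refl

arrows-exists : ∀ k (Q : Fin (suc k) → PointSet) → ∃[ P ] Arrows P Q
arrows-exists zero    Q = Q zero , arrows-one-colour Q
arrows-exists (suc k) Q =
  let A , A→Q       = arrows-exists k (Q ∘ suc)
      P , inflation = inflation-exists A (Q zero)
  in  P , inflation-arrows {Q = Q} inflation A→Q

lemma1 : (k : ℕ) → 1 ℕ.≤ k → (Q : Fin k → PointSet) → ∃[ P ] Arrows P Q
lemma1 (suc k) _ Q = arrows-exists k Q
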